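{- Let $G_n$ be the graph defined below. There is an absolute constant $C$ such that $\mathbf{bp}(G_n) \leq C n^5$ for all $n\geq 1$, i.e. $\mathbf{bp}(G_n)=O(n^5)$.
   Context: Let $Q_k=\{0,1\}^k$, $0^k$ and $1^k$ the all-zero and all-one vectors, $Q_k^- = Q_k\setminus\{0^k,1^k\}$, and for $X\subset Q_k$, $Y\subset Q_\ell$ let $X\times Y\subset Q_{k+\ell}$ be the set of concatenations $(x,y)$ with $x\in X$, $y\in Y$. Let $S = Q_7 \setminus \big[(1^4\times Q_3^-) \cup \{0^4\times 0^3\}\cup\{0^4\times 1^3\}\big]$. For a positive integer $n$, let $G_n$ be the graph with vertex set $[n]^7$, where for $x,y\in[n]^7$ we define $\rho(x,y)\in Q_7$ by $\rho_i(x,y)=1$ if $x_i\neq y_i$ and $0$ otherwise; $x,y$ are adjacent iff $\rho(x,y)\in S$. $\mathbf{bp}(G)$ is the minimum number of complete bipartite graphs whose edge sets partition the edge set of $G$. -}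

module Defs where

open import Data.Bool using (Bool; true; false; not; _∧_; _∨_)
open import Data.Nat using (ℕ; zero; suc; _+_; _*_; _^_; _≤_)
open import Data.Fin using (Fin; _≟_)
open import Data.Vec using (Vec; []; _∷_; zipWith; splitAt; replicate)
open import Data.Product using (Σ; _×_; _,_; proj₁; proj₂)
open import Data.Sum using (_⊎_)
open import Relation.Binary.PropositionalEquality using (_≡_)
open import Relation.Nullary.Decidable using (⌊_⌋)

-- Q_k = {0,1}^k, with 1 = true, 0 = false
Q : ℕ → Set
Q k = Vec Bool k

all1 : ∀ {k} → Q k → Bool
all1 [] = true
all1 (b ∷ v) = b ∧ all1 v

all0 : ∀ {k} → Q k → Bool
all0 [] = true
all0 (b ∷ v) = not b ∧ all0 v

inQ⁻ : ∀ {k} → Q k → Bool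
inQ⁻ v = not (all0 v ∨ all1 v)

inS : Q 7 → Bool
inS v with splitAt 4 v
... | (u , w , _) =
  not ((all1 u ∧ inQ⁻ w) ∨ (all0 u ∧ all0 w) ∨ (all0 u ∧ all1 w))

Vertex : ℕ → Set
Vertex n = Vec (Fin n) 7

ρ : ∀ {n} → Vertex n → Vertex n → Q 7
ρ x y = zipWith (λ a b → not ⌊ a ≟ b ⌋) x y

Adj : (n : ℕ) → Vertex n → Vertex n → Set
Adj n x y = inS (ρ x y) ≡ true

-- A graph on a vertex type V given by an adjacency relation.
-- A complete bipartite graph is given by two vertex sets (A , B); its edges
-- are the pairs {a , b} with a ∈ A, b ∈ B.
Biclique : Set → Set
Biclique V = (V → Bool) × (V → Bool)

InBiclique : ∀ {V} → Biclique V → V → V → Set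
InBiclique (A , B) x y = (A x ≡ true × B y ≡ true) ⊎ (A y ≡ true × B x ≡ true)

record BicliquePartition (V : Set) (E : V → V → Set) (k : ℕ) : Set where
  field
    part     : Fin k → Biclique V
    sound    : ∀ i x y → InBiclique (part i) x y → E x y
    covers   : ∀ x y → E x y → Σ (Fin k) λ i → InBiclique (part i) x y
    unique   : ∀ x y → E x y → ∀ i j →
                 InBiclique (part i) x y → InBiclique (part j) x y → i ≡ j

bp≤ : (V : Set) → (V → V → Set) → ℕ → Set
bp≤ V E k = Σ ℕ λ m → m ≤ k × BicliquePartition V E m

-- Record for a pair of vertices x, y its sign pattern σ ∈ {<, =, >}⁷, σᵢ comparing xᵢ
-- with yᵢ; adjacency depends only on the support of σ. The patterns whose support lies
-- in S are split, up to exchanging x and y, into 17 boxes: products of sign sets that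
-- constrain five coordinates and leave two free. For such a box, fixing x on the five
-- constrained coordinates to some κ ∈ [n]⁵ and letting y range over the vertices that
-- compare with κ as the box prescribes gives a biclique, and these n⁵ bicliques
-- partition the edges whose pattern lies in the box. Hence bp(Gₙ) ≤ 17 n⁵.
module Submission where

open import Defs
open import Data.Nat using (ℕ; suc; _*_; _^_)
open import Data.Product using (Σ)

open import Data.Bool using (Bool; true; false; not)
open import Data.Bool.Properties using () renaming (_≟_ to _≟ᵇ_)
open import Data.Empty using (⊥; ⊥-elim)
open import Data.Fin using (Fin; zero; suc; #_; _≟_; combine; remQuot; finToFun; funToFin)
open import Data.Fin.Properties using (<-cmp; all?; any?; remQuot-combine; combine-remQuot;
  funToFin-finToFin; finToFun-funToFin)
open import Data.Nat using (zero)
open import Data.Nat.Properties using (≤-refl)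
open import Data.Product using (∃-syntax; _×_; _,_; proj₁; proj₂)
open import Data.Sum using (_⊎_; inj₁; inj₂)
import Data.Sum as Sum
open import Data.Vec using (Vec; []; _∷_; lookup; map; zipWith)
open import Data.Vec.Properties using (lookup-zipWith)
open import Function using (_∘_)
open import Relation.Binary.Definitions using (tri<; tri≈; tri>)
open import Relation.Binary.PropositionalEquality
  using (_≡_; _≗_; refl; sym; trans; cong; cong₂; subst; module ≡-Reasoning)
open import Relation.Nullary using (Dec; yes; no; ¬?; _×-dec_; _⊎-dec_; _→-dec_)
open import Relation.Nullary.Decidable using (⌊_⌋; does; map′; dec-true; from-yes)

data Sign : Set where
  lt eq gt : Sign

opposite : Sign → Sign
opposite lt = gt
opposite eq = eq
opposite gt = lt

SignSet : Set
SignSet = Sign → Bool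

only : Sign → SignSet
only lt lt = true
only eq eq = true
only gt gt = true
only _  _  = false

nonzero : SignSet
nonzero eq = false
nonzero _  = true

anySign : SignSet
anySign _ = true

sign : ∀ {N} → Fin N → Fin N → Sign
sign a b with <-cmp a b
... | tri< _ _ _ = lt
... | tri≈ _ _ _ = eq
... | tri> _ _ _ = gt

nonzero-sign : ∀ {N} (a b : Fin N) → nonzero (sign a b) ≡ not ⌊ a ≟ b ⌋
nonzero-sign a b with <-cmp a b | a ≟ b
... | tri< _ a≢b _ | yes a≡b = ⊥-elim (a≢b a≡b)
... | tri< _ _ _   | no _    = refl
... | tri≈ _ _ _   | yes _   = refl
... | tri≈ _ a≡b _ | no a≢b  = ⊥-elim (a≢b a≡b)
... | tri> _ a≢b _ | yes a≡b = ⊥-elim (a≢b a≡b)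
... | tri> _ _ _   | no _    = refl

sign-swap : ∀ {N} (a b : Fin N) → sign b a ≡ opposite (sign a b)
sign-swap a b with <-cmp a b | <-cmp b a
... | tri< a<b _ _ | tri< _ _ a≮b   = ⊥-elim (a≮b a<b)
... | tri< _ a≢b _ | tri≈ _ b≡a _   = ⊥-elim (a≢b (sym b≡a))
... | tri< _ _ _   | tri> _ _ _     = refl
... | tri≈ _ a≡b _ | tri< _ b≢a _   = ⊥-elim (b≢a (sym a≡b))
... | tri≈ _ _ _   | tri≈ _ _ _     = refl
... | tri≈ _ a≡b _ | tri> _ b≢a _   = ⊥-elim (b≢a (sym a≡b))
... | tri> _ _ _   | tri< _ _ _     = refl
... | tri> _ a≢b _ | tri≈ _ b≡a _   = ⊥-elim (a≢b (sym b≡a))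
... | tri> a≮b _ _ | tri> _ _ a<b   = ⊥-elim (a≮b a<b)

all-sign? : {P : Sign → Set} → (∀ s → Dec (P s)) → Dec (∀ s → P s)
all-sign? P? = map′ (λ { (p , q , r) → λ { lt → p ; eq → q ; gt → r } })
                    (λ h → h lt , h eq , h gt)
                    (P? lt ×-dec P? eq ×-dec P? gt)

all-signs? : ∀ {k} {P : Vec Sign k → Set} → (∀ σ → Dec (P σ)) → Dec (∀ σ → P σ)
all-signs? {zero}  P? = map′ (λ { p [] → p }) (λ h → h []) (P? [])
all-signs? {suc k} P? = map′ (λ { h (s ∷ σ) → h s σ }) (λ h s σ → h (s ∷ σ))
                             (all-sign? λ s → all-signs? λ σ → P? (s ∷ σ))

disagreement : ∀ {k N} → Vec (Fin N) k → Vec (Fin N) k → Q k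
disagreement = zipWith (λ a b → not ⌊ a ≟ b ⌋)

signs : ∀ {k N} → Vec (Fin N) k → Vec (Fin N) k → Vec Sign k
signs = zipWith sign

support : ∀ {k} → Vec Sign k → Q k
support = map nonzero

support-signs : ∀ {k N} (x y : Vec (Fin N) k) → support (signs x y) ≡ disagreement x y
support-signs []      []      = refl
support-signs (a ∷ x) (b ∷ y) = cong₂ _∷_ (nonzero-sign a b) (support-signs x y)

signs-swap : ∀ {k N} (x y : Vec (Fin N) k) → signs y x ≡ map opposite (signs x y)
signs-swap []      []      = refl
signs-swap (a ∷ x) (b ∷ y) = cong₂ _∷_ (sign-swap a b) (signs-swap x y)

support-opposite : ∀ {k} (σ : Vec Sign k) → support (map opposite σ) ≡ support σ
support-opposite []       = refl
support-opposite (lt ∷ σ) = cong (true ∷_) (support-opposite σ)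
support-opposite (eq ∷ σ) = cong (false ∷_) (support-opposite σ)
support-opposite (gt ∷ σ) = cong (true ∷_) (support-opposite σ)

-- The box {σ : σ (pin j) ∈ allowed j for all j}; coordinates that are not pinned are free.
Box : ℕ → ℕ → Set
Box k p = Vec (Fin k × SignSet) p

module _ {k p} (B : Box k p) where

  pin : Fin p → Fin k
  pin j = proj₁ (lookup B j)

  allowed : Fin p → SignSet
  allowed j = proj₂ (lookup B j)

  restrict : ∀ {N} → Vec (Fin N) k → Fin p → Fin N
  restrict x j = lookup x (pin j)

_∈ᵇ_ : ∀ {k p} → Vec Sign k → Box k p → Set
σ ∈ᵇ B = ∀ j → allowed B j (lookup σ (pin B j)) ≡ true

_∈ᵇ?_ : ∀ {k p} (σ : Vec Sign k) (B : Box k p) → Dec (σ ∈ᵇ B)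
σ ∈ᵇ? B = all? λ j → allowed B j (lookup σ (pin B j)) ≟ᵇ true

-- The boxes together with their opposites partition the sign patterns with support in S.
record SignPartition {k p m} (S : Q k → Bool) (box : Fin m → Box k p) : Set where
  field
    sound             : ∀ b σ → σ ∈ᵇ box b → S (support σ) ≡ true
    complete          : ∀ σ → S (support σ) ≡ true →
                        ∃[ b ] (σ ∈ᵇ box b ⊎ map opposite σ ∈ᵇ box b)
    disjoint          : ∀ σ b → σ ∈ᵇ box b → ∀ c → σ ∈ᵇ box c → b ≡ c
    disjoint-opposite : ∀ σ b → σ ∈ᵇ box b → ∀ c → map opposite σ ∈ᵇ box c → ⊥

module _ {k p m} (box : Fin m → Box k p) where

  sound? : (S : Q k → Bool) → Dec (∀ b σ → σ ∈ᵇ box b → S (support σ) ≡ true)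
  sound? S = all? λ b → all-signs? λ σ → σ ∈ᵇ? box b →-dec S (support σ) ≟ᵇ true

  complete? : (S : Q k → Bool) →
              Dec (∀ σ → S (support σ) ≡ true → ∃[ b ] (σ ∈ᵇ box b ⊎ map opposite σ ∈ᵇ box b))
  complete? S = all-signs? λ σ → S (support σ) ≟ᵇ true →-dec
                any? λ b → σ ∈ᵇ? box b ⊎-dec map opposite σ ∈ᵇ? box b

  disjoint? : Dec (∀ σ b → σ ∈ᵇ box b → ∀ c → σ ∈ᵇ box c → b ≡ c)
  disjoint? = all-signs? λ σ → all? λ b → σ ∈ᵇ? box b →-dec all? λ c → σ ∈ᵇ? box c →-dec b ≟ c

  disjoint-opposite? : Dec (∀ σ b → σ ∈ᵇ box b → ∀ c → map opposite σ ∈ᵇ box c → ⊥)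
  disjoint-opposite? =
    all-signs? λ σ → all? λ b → σ ∈ᵇ? box b →-dec all? λ c → ¬? (map opposite σ ∈ᵇ? box c)

witness : ∀ {A : Set} (a? : Dec A) → does a? ≡ true → A
witness (yes a) _ = a

module _ {k p N} (B : Box k p) (κ : Fin p → Fin N) where

  pinned? : ∀ x → Dec (κ ≗ restrict B x)
  pinned? x = all? λ j → κ j ≟ restrict B x j

  compared? : ∀ y → Dec (∀ j → allowed B j (sign (κ j) (restrict B y j)) ≡ true)
  compared? y = all? λ j → allowed B j (sign (κ j) (restrict B y j)) ≟ᵇ true

  boxBiclique : Biclique (Vec (Fin N) k)
  boxBiclique = does ∘ pinned? , does ∘ compared?

  allowed-signs : ∀ x y → κ ≗ restrict B x → ∀ j →
                  allowed B j (lookup (signs x y) (pin B j)) ≡ allowed B j (sign (κ j) (restrict B y j))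
  allowed-signs x y κ≗x j = begin
    allowed B j (lookup (zipWith sign x y) (pin B j))     ≡⟨ cong (allowed B j) (lookup-zipWith sign (pin B j) x y) ⟩
    allowed B j (sign (restrict B x j) (restrict B y j))  ≡⟨ cong (λ a → allowed B j (sign a (restrict B y j))) (sym (κ≗x j)) ⟩
    allowed B j (sign (κ j) (restrict B y j))             ∎
    where open ≡-Reasoning

  boxBiclique-edge : ∀ x y → does (pinned? x) ≡ true → does (compared? y) ≡ true →
                     κ ≗ restrict B x × signs x y ∈ᵇ B
  boxBiclique-edge x y x∈ y∈ =
    κ≗x , λ j → trans (allowed-signs x y κ≗x j) (witness (compared? y) y∈ j)
    where κ≗x = witness (pinned? x) x∈

  boxBiclique-edge⁻¹ : ∀ x y → κ ≗ restrict B x → signs x y ∈ᵇ B →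
                       does (pinned? x) ≡ true × does (compared? y) ≡ true
  boxBiclique-edge⁻¹ x y κ≗x σ∈ =
    dec-true (pinned? x) κ≗x ,
    dec-true (compared? y) (λ j → trans (sym (allowed-signs x y κ≗x j)) (σ∈ j))

  boxBiclique-edges : ∀ {x y} → InBiclique boxBiclique x y →
                      (κ ≗ restrict B x × signs x y ∈ᵇ B) ⊎ (κ ≗ restrict B y × signs y x ∈ᵇ B)
  boxBiclique-edges {x} {y} =
    Sum.map (λ (x∈ , y∈) → boxBiclique-edge x y x∈ y∈) (λ (y∈ , x∈) → boxBiclique-edge y x y∈ x∈)

funToFin-cong : ∀ {p N} {f g : Fin p → Fin N} → f ≗ g → funToFin f ≡ funToFin g
funToFin-cong {zero}  _   = refl
funToFin-cong {suc p} f≗g = cong₂ combine (f≗g zero) (funToFin-cong (f≗g ∘ suc))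

module Index (m p N : ℕ) where

  decode : Fin (m * N ^ p) → Fin m × (Fin p → Fin N)
  decode i = proj₁ (remQuot {m} (N ^ p) i) , finToFun (proj₂ (remQuot {m} (N ^ p) i))

  encode : Fin m → (Fin p → Fin N) → Fin (m * N ^ p)
  encode b κ = combine b (funToFin κ)

  decode-encode : ∀ b κ → proj₁ (decode (encode b κ)) ≡ b × proj₂ (decode (encode b κ)) ≗ κ
  decode-encode b κ =
    cong proj₁ rq , λ j → trans (cong (λ r → finToFun (proj₂ r) j) rq) (finToFun-funToFin κ j)
    where rq = remQuot-combine {m} {N ^ p} b (funToFin κ)

  encode-decode : ∀ i → encode (proj₁ (decode i)) (proj₂ (decode i)) ≡ i
  encode-decode i = trans (cong (combine b) (funToFin-finToFin {p} {N} c)) (combine-remQuot {m} (N ^ p) i)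
    where
    b = proj₁ (remQuot {m} (N ^ p) i)
    c = proj₂ (remQuot {m} (N ^ p) i)

  decode-injective : ∀ i j →
                     proj₁ (decode i) ≡ proj₁ (decode j) → proj₂ (decode i) ≗ proj₂ (decode j) → i ≡ j
  decode-injective i j b≡ κ≗ = begin
    i                                          ≡⟨ sym (encode-decode i) ⟩
    encode (proj₁ (decode i)) (proj₂ (decode i)) ≡⟨ cong₂ combine b≡ (funToFin-cong κ≗) ⟩
    encode (proj₁ (decode j)) (proj₂ (decode j)) ≡⟨ encode-decode j ⟩
    j                                          ∎
    where open ≡-Reasoning

module _ {k p m} {S : Q k → Bool} {box : Fin m → Box k p} (partition : SignPartition S box) (N : ℕ) where

  open SignPartition partition
  open Index m p N

  DisagreementGraph : Vec (Fin N) k → Vec (Fin N) k → Set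
  DisagreementGraph x y = S (disagreement x y) ≡ true

  biclique : Fin (m * N ^ p) → Biclique (Vec (Fin N) k)
  biclique i = boxBiclique (box (proj₁ (decode i))) (proj₂ (decode i))

  adjacent-by-signs : ∀ x y → S (support (signs x y)) ≡ true → DisagreementGraph x y
  adjacent-by-signs x y = subst (λ d → S d ≡ true) (support-signs x y)

  adjacent-by-swapped-signs : ∀ x y → S (support (signs y x)) ≡ true → DisagreementGraph x y
  adjacent-by-swapped-signs x y h = adjacent-by-signs x y (begin
    S (support (signs x y))                  ≡⟨ cong (S ∘ support) (signs-swap y x) ⟩
    S (support (map opposite (signs y x)))   ≡⟨ cong S (support-opposite (signs y x)) ⟩
    S (support (signs y x))                  ≡⟨ h ⟩
    true                                     ∎)
    where open ≡-Reasoning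

  biclique-sound : ∀ i x y → InBiclique (biclique i) x y → DisagreementGraph x y
  biclique-sound i x y e with boxBiclique-edges (box (proj₁ (decode i))) (proj₂ (decode i)) {x} {y} e
  ... | inj₁ (_ , σ∈) = adjacent-by-signs x y (sound _ (signs x y) σ∈)
  ... | inj₂ (_ , σ∈) = adjacent-by-swapped-signs x y (sound _ (signs y x) σ∈)

  decoded-edge : ∀ i {b x y} → proj₁ (decode i) ≡ b → proj₂ (decode i) ≗ restrict (box b) x →
                 signs x y ∈ᵇ box b → proj₁ (biclique i) x ≡ true × proj₂ (biclique i) y ≡ true
  decoded-edge i {x = x} {y} refl =
    boxBiclique-edge⁻¹ (box (proj₁ (decode i))) (proj₂ (decode i)) x y

  encode-edge : ∀ b x y → signs x y ∈ᵇ box b →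
                let i = encode b (restrict (box b) x) in
                proj₁ (biclique i) x ≡ true × proj₂ (biclique i) y ≡ true
  encode-edge b x y = decoded-edge _ {b} {x} {y} b≡ κ≗x
    where
    b≡ = proj₁ (decode-encode b (restrict (box b) x))
    κ≗x = proj₂ (decode-encode b (restrict (box b) x))

  biclique-covers : ∀ x y → DisagreementGraph x y → ∃[ i ] InBiclique (biclique i) x y
  biclique-covers x y adj
    with complete (signs x y) (subst (λ d → S d ≡ true) (sym (support-signs x y)) adj)
  ... | b , inj₁ σ∈ = encode b (restrict (box b) x) , inj₁ (encode-edge b x y σ∈)
  ... | b , inj₂ σ∈ = encode b (restrict (box b) y) ,
                      inj₂ (encode-edge b y x (subst (_∈ᵇ box b) (sym (signs-swap x y)) σ∈))

  same-index : ∀ i j x → proj₁ (decode i) ≡ proj₁ (decode j) →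
               proj₂ (decode i) ≗ restrict (box (proj₁ (decode i))) x →
               proj₂ (decode j) ≗ restrict (box (proj₁ (decode j))) x → i ≡ j
  same-index i j x b≡ κᵢ≗x κⱼ≗x = decode-injective i j b≡ λ t →
    trans (κᵢ≗x t) (trans (cong (λ b → restrict (box b) x t) b≡) (sym (κⱼ≗x t)))

  biclique-unique : ∀ x y → DisagreementGraph x y → ∀ i j →
                    InBiclique (biclique i) x y → InBiclique (biclique j) x y → i ≡ j
  biclique-unique x y _ i j eᵢ eⱼ
    with boxBiclique-edges (box (proj₁ (decode i))) (proj₂ (decode i)) {x} {y} eᵢ
       | boxBiclique-edges (box (proj₁ (decode j))) (proj₂ (decode j)) {x} {y} eⱼ
  ... | inj₁ (κᵢ , σᵢ) | inj₁ (κⱼ , σⱼ) = same-index i j x (disjoint (signs x y) _ σᵢ _ σⱼ) κᵢ κⱼ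
  ... | inj₂ (κᵢ , σᵢ) | inj₂ (κⱼ , σⱼ) = same-index i j y (disjoint (signs y x) _ σᵢ _ σⱼ) κᵢ κⱼ
  ... | inj₁ (_ , σᵢ)  | inj₂ (_ , σⱼ) =
    ⊥-elim (disjoint-opposite (signs x y) _ σᵢ _
             (subst (_∈ᵇ box (proj₁ (decode j))) (signs-swap x y) σⱼ))
  ... | inj₂ (_ , σᵢ)  | inj₁ (_ , σⱼ) =
    ⊥-elim (disjoint-opposite (signs x y) _ σⱼ _
             (subst (_∈ᵇ box (proj₁ (decode i))) (signs-swap x y) σᵢ))

  bp≤-signPartition : bp≤ (Vec (Fin N) k) DisagreementGraph (m * N ^ p)
  bp≤-signPartition = m * N ^ p , ≤-refl , record
    { part = biclique ; sound = biclique-sound ; covers = biclique-covers ; unique = biclique-unique }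

-- Coordinates 0–3 are the Q₄ factor of S. A coordinate pinned with anySign only splits
-- bicliques further; it pads every box to five pinned coordinates.
boxes : Vec (Box 7 5) 17
boxes =
    ((# 1 , only lt)   ∷ (# 3 , anySign)   ∷ (# 4 , only eq)   ∷ (# 5 , only eq)   ∷ (# 6 , only eq)   ∷ [])
  ∷ ((# 1 , only eq)   ∷ (# 3 , only lt)   ∷ (# 4 , anySign)   ∷ (# 5 , anySign)   ∷ (# 6 , anySign)   ∷ [])
  ∷ ((# 1 , only eq)   ∷ (# 2 , only lt)   ∷ (# 3 , only eq)   ∷ (# 5 , anySign)   ∷ (# 6 , anySign)   ∷ [])
  ∷ ((# 0 , only gt)   ∷ (# 1 , only eq)   ∷ (# 2 , only eq)   ∷ (# 3 , only eq)   ∷ (# 6 , anySign)   ∷ [])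
  ∷ ((# 0 , only eq)   ∷ (# 2 , only eq)   ∷ (# 3 , only eq)   ∷ (# 4 , only eq)   ∷ (# 6 , only lt)   ∷ [])
  ∷ ((# 0 , only eq)   ∷ (# 2 , only eq)   ∷ (# 3 , only eq)   ∷ (# 5 , only lt)   ∷ (# 6 , only eq)   ∷ [])
  ∷ ((# 0 , only eq)   ∷ (# 2 , only eq)   ∷ (# 3 , only eq)   ∷ (# 4 , only lt)   ∷ (# 5 , only eq)   ∷ [])
  ∷ ((# 0 , only eq)   ∷ (# 1 , nonzero)   ∷ (# 2 , only lt)   ∷ (# 4 , only eq)   ∷ (# 6 , nonzero)   ∷ [])
  ∷ ((# 0 , only eq)   ∷ (# 1 , nonzero)   ∷ (# 2 , only lt)   ∷ (# 5 , nonzero)   ∷ (# 6 , only eq)   ∷ [])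
  ∷ ((# 0 , only eq)   ∷ (# 1 , nonzero)   ∷ (# 2 , only lt)   ∷ (# 4 , nonzero)   ∷ (# 5 , only eq)   ∷ [])
  ∷ ((# 1 , only lt)   ∷ (# 2 , only eq)   ∷ (# 3 , nonzero)   ∷ (# 4 , only eq)   ∷ (# 6 , nonzero)   ∷ [])
  ∷ ((# 1 , only lt)   ∷ (# 2 , only eq)   ∷ (# 3 , nonzero)   ∷ (# 5 , nonzero)   ∷ (# 6 , only eq)   ∷ [])
  ∷ ((# 1 , only lt)   ∷ (# 2 , only eq)   ∷ (# 3 , nonzero)   ∷ (# 4 , nonzero)   ∷ (# 5 , only eq)   ∷ [])
  ∷ ((# 0 , nonzero)   ∷ (# 1 , nonzero)   ∷ (# 3 , only eq)   ∷ (# 4 , only eq)   ∷ (# 6 , only lt)   ∷ [])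
  ∷ ((# 0 , nonzero)   ∷ (# 1 , nonzero)   ∷ (# 3 , only eq)   ∷ (# 5 , only lt)   ∷ (# 6 , only eq)   ∷ [])
  ∷ ((# 0 , nonzero)   ∷ (# 1 , nonzero)   ∷ (# 3 , only eq)   ∷ (# 4 , only lt)   ∷ (# 5 , only eq)   ∷ [])
  ∷ ((# 1 , nonzero)   ∷ (# 3 , anySign)   ∷ (# 4 , only gt)   ∷ (# 5 , nonzero)   ∷ (# 6 , nonzero)   ∷ [])
  ∷ []

boxes-partition : SignPartition inS (lookup boxes)
boxes-partition = record
  { sound             = from-yes (sound? (lookup boxes) inS)
  ; complete          = from-yes (complete? (lookup boxes) inS)
  ; disjoint          = from-yes (disjoint? (lookup boxes))
  ; disjoint-opposite = from-yes (disjoint-opposite? (lookup boxes))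
  }

proposition2p3 : Σ ℕ λ C → (n : ℕ) → bp≤ (Vertex (suc n)) (Adj (suc n)) (C * suc n ^ 5)
proposition2p3 = 17 , λ n → bp≤-signPartition boxes-partition (suc n)
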